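{- Let $n$ be a positive integer and let $\varphi(n)$ denote the minimum of all the sums $r_1+s_1+s_2+\dots+s_t$, taken over all choices of positive integers $t,r_1,\dots,r_t,s_1,\dots,s_t$ such that $n=\sum_{i=1}^t r_is_i$ and $r_1>r_2>\dots>r_t$ (the last condition being vacuous when $t=1$). Then: (i) There is a uniquely determined positive integer $k$ such that $k^2-k+1\le n\le k^2+k$. (ii) If, for this $k$, $n\le k^2$, then $\varphi(n)=2k$. (iii) If, for this $k$, $k^2+1\le n$, then $\varphi(n)=2k+1$. -}

module Defs where

open import Data.Nat using (ℕ; zero; suc; _+_; _*_; _≤_; _<_; _>_)
open import Data.Product using (_×_; _,_; proj₁; proj₂; Σ; ∃)
open import Data.List using (List; []; _∷_; map)
open import Data.Nat.ListAction using (sum)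
open import Data.List.Relation.Unary.All using (All)
open import Data.List.Relation.Unary.Linked using (Linked)
open import Relation.Binary.PropositionalEquality using (_≡_)

Pair : Set
Pair = ℕ × ℕ

PositivePair : Pair → Set
PositivePair (r , s) = (0 < r) × (0 < s)

_r>_ : Pair → Pair → Set
p r> q = proj₁ p > proj₁ q

weight : List Pair → ℕ
weight ps = sum (map (λ p → proj₁ p * proj₂ p) ps)

record Rep (n : ℕ) : Set where
  constructor rep
  field
    r₁ s₁   : ℕ
    rest    : List Pair
    pos     : All PositivePair ((r₁ , s₁) ∷ rest)
    decr    : Linked _r>_ ((r₁ , s₁) ∷ rest)
    total   : weight ((r₁ , s₁) ∷ rest) ≡ n

cost : ∀ {n} → Rep n → ℕ
cost R = Rep.r₁ R + Rep.s₁ R + sum (map proj₂ (Rep.rest R))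

IsPhi : ℕ → ℕ → Set
IsPhi n m = (Σ (Rep n) λ R → cost R ≡ m) × (∀ (R : Rep n) → m ≤ cost R)

-- As r₁ > r₂ > … > rₜ, n = Σ rᵢ sᵢ ≤ r₁ (s₁ + … + sₜ), so a representation of cost c yields
-- a, b with a + b = c and n ≤ a b.  For a fixed sum the balanced split maximises a b, so cost
-- 2k − 1 resp. 2k forces n ≤ (k − 1) k resp. n ≤ k², which gives the lower bounds.  They are
-- attained by writing n = k q + m with 0 < m ≤ k (q = k − 1 resp. q = k) and taking the pairs
-- (k , q), (m , 1), merged into (k , q + 1) when m = k.
module Submission where

open import Defs
open import Data.Nat using (ℕ; zero; suc; _+_; _*_; _∸_; _≤_; _<_; _≤?_; z≤n; s≤s; z<s)
open import Data.Nat.Properties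
open import Data.Nat.Tactic.RingSolver using (solve-∀)
open import Data.Product using (_×_; Σ; ∃; _,_; proj₂)
open import Data.Sum using (inj₁; inj₂)
open import Data.List using ([]; _∷_; map)
open import Data.Nat.ListAction using (sum)
open import Data.List.Relation.Unary.All using ([]; _∷_)
open import Data.List.Relation.Unary.Linked using (Linked; [-]; _∷_)
open import Relation.Nullary using (yes; no; contradiction)
open import Relation.Binary.Definitions using (tri<; tri≈; tri>)
open import Relation.Binary.PropositionalEquality

*-≤-balanced : ∀ k e a b → e ≤ 1 → a + b ≤ k + (e + k) → a * b ≤ k * (e + k)
*-≤-balanced k e zero b _ _ = z≤n
*-≤-balanced k e (suc a) zero _ _ = ≤-trans (≤-reflexive (*-zeroʳ a)) z≤n
*-≤-balanced zero e (suc a) (suc b) e≤1 h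
  with ≤-trans (m≤n+m (suc b) a) (≤-pred (≤-trans h (≤-trans (≤-reflexive (+-identityʳ e)) e≤1)))
... | ()
*-≤-balanced (suc k) e (suc a) (suc b) e≤1 h = begin
  suc a * suc b                   ≡⟨ expandˡ a b ⟩
  a * b + (a + b + 1)             ≤⟨ +-mono-≤ (*-≤-balanced k e a b e≤1 h′) (+-monoˡ-≤ 1 h′) ⟩
  k * (e + k) + (k + (e + k) + 1) ≡⟨ expandʳ k e ⟩
  suc k * (e + suc k)             ∎
  where
  open ≤-Reasoning
  expandˡ : ∀ a b → suc a * suc b ≡ a * b + (a + b + 1)
  expandˡ = solve-∀
  expandʳ : ∀ k e → k * (e + k) + (k + (e + k) + 1) ≡ suc k * (e + suc k)
  expandʳ = solve-∀
  shiftˡ : ∀ a b → suc a + suc b ≡ 2 + (a + b)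
  shiftˡ = solve-∀
  shiftʳ : ∀ k e → suc k + (e + suc k) ≡ 2 + (k + (e + k))
  shiftʳ = solve-∀
  h′ : a + b ≤ k + (e + k)
  h′ = +-cancelˡ-≤ 2 _ _ (subst₂ _≤_ (shiftˡ a b) (shiftʳ k e) h)

+-<-balanced : ∀ k e {a b} → e ≤ 1 → k * (e + k) < a * b → k + (e + k) < a + b
+-<-balanced k e {a} {b} e≤1 k[e+k]<ab =
  ≰⇒> (λ a+b≤ → <⇒≱ k[e+k]<ab (*-≤-balanced k e a b e≤1 a+b≤))

weight-tail-≤ : ∀ r s ps → Linked _r>_ ((r , s) ∷ ps) → weight ps ≤ r * sum (map proj₂ ps)
weight-tail-≤ r s [] _ = z≤n
weight-tail-≤ r s ((r′ , s′) ∷ ps) (r>r′ ∷ decr) = begin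
  r′ * s′ + weight ps                   ≤⟨ +-mono-≤ (*-monoˡ-≤ s′ r′≤r) weight-ps≤ ⟩
  r * s′ + r * sum (map proj₂ ps)       ≡⟨ *-distribˡ-+ r s′ _ ⟨
  r * (s′ + sum (map proj₂ ps))         ∎
  where
  open ≤-Reasoning
  r′≤r : r′ ≤ r
  r′≤r = <⇒≤ r>r′
  weight-ps≤ : weight ps ≤ r * sum (map proj₂ ps)
  weight-ps≤ = ≤-trans (weight-tail-≤ r′ s′ ps decr) (*-monoˡ-≤ _ r′≤r)

weight≤head*sum : ∀ r s ps → Linked _r>_ ((r , s) ∷ ps) →
                  weight ((r , s) ∷ ps) ≤ r * (s + sum (map proj₂ ps))
weight≤head*sum r s ps decr = begin
  r * s + weight ps                 ≤⟨ +-monoʳ-≤ (r * s) (weight-tail-≤ r s ps decr) ⟩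
  r * s + r * sum (map proj₂ ps)    ≡⟨ *-distribˡ-+ r s _ ⟨
  r * (s + sum (map proj₂ ps))      ∎
  where open ≤-Reasoning

cost-lower-bound : ∀ {n} k e → e ≤ 1 → k * (e + k) < n → (R : Rep n) → k + (e + k) < cost R
cost-lower-bound {n} k e e≤1 k[e+k]<n (rep r₁ s₁ rest _ decr total) =
  subst (k + (e + k) <_) (sym (+-assoc r₁ s₁ _))
        (+-<-balanced k e {r₁} {ssum} e≤1 (<-≤-trans k[e+k]<n n≤r₁*ssum))
  where
  ssum : ℕ
  ssum = s₁ + sum (map proj₂ rest)
  n≤r₁*ssum : n ≤ r₁ * ssum
  n≤r₁*ssum = subst (_≤ r₁ * ssum) total (weight≤head*sum r₁ s₁ rest decr)

rep-with-cost : ∀ {n} k q → k ≤ n → k * q < n → n ≤ k * q + k →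
                Σ (Rep n) λ R → cost R ≡ k + q + 1
rep-with-cost {n} k q k≤n kq<n n≤kq+k with m≤n⇒m<n∨m≡n n≤kq+k
... | inj₂ n≡kq+k =
  rep k (suc q) [] ((0<k , z<s) ∷ []) [-] (trans (weight≡ k q) (sym n≡kq+k)) , cost≡ k q
  where
  weight≡ : ∀ k q → k * suc q + 0 ≡ k * q + k
  weight≡ = solve-∀
  cost≡ : ∀ k q → k + suc q + 0 ≡ k + q + 1
  cost≡ = solve-∀
  0<k : 0 < k
  0<k = +-cancelˡ-< (k * q) 0 k (subst₂ _<_ (sym (+-identityʳ (k * q))) n≡kq+k kq<n)
... | inj₁ n<kq+k = rep k q ((m , 1) ∷ []) ((0<k , 0<q q n≡kq+m) ∷ (0<m , z<s) ∷ []) (m<k ∷ [-]) total , refl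
  where
  m = n ∸ k * q
  n≡kq+m : k * q + m ≡ n
  n≡kq+m = m+[n∸m]≡n (<⇒≤ kq<n)
  0<m : 0 < m
  0<m = m<n⇒0<n∸m kq<n
  m<k : m < k
  m<k = +-cancelˡ-< (k * q) m k (subst (_< k * q + k) (sym n≡kq+m) n<kq+k)
  0<k : 0 < k
  0<k = <-trans 0<m m<k
  0<q : ∀ q → k * q + m ≡ n → 0 < q
  0<q zero n≡ = contradiction (subst (k ≤_) (trans (sym n≡) (cong (_+ m) (*-zeroʳ k))) k≤n) (<⇒≱ m<k)
  0<q (suc q) _ = z<s
  total : k * q + (m * 1 + 0) ≡ n
  total = trans (cong (k * q +_) (trans (+-identityʳ _) (*-identityʳ m))) n≡kq+m

e+c≤1+c*[e+c] : ∀ c e → e ≤ 1 → e + c ≤ suc (c * (e + c))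
e+c≤1+c*[e+c] zero e e≤1 = ≤-trans (≤-reflexive (+-identityʳ e)) e≤1
e+c≤1+c*[e+c] (suc c) e _ = ≤-trans (m≤m+n (e + suc c) _) (n≤1+n _)

isPhi-balanced : ∀ {n} c e → e ≤ 1 → c * (e + c) < n → n ≤ (e + c) * suc c →
                 IsPhi n (c + (e + c) + 1)
isPhi-balanced {n} c e e≤1 lo hi
  with rep-with-cost (e + c) c (≤-trans (e+c≤1+c*[e+c] c e e≤1) lo) (subst (_< n) (*-comm c (e + c)) lo)
                     (subst (n ≤_) (trans (*-suc (e + c) c) (+-comm (e + c) _)) hi)
... | R , cost≡ = (R , trans cost≡ (rearrange e c)) ,
                  λ R′ → subst (_≤ cost R′) (+-comm 1 _) (cost-lower-bound c e e≤1 lo R′)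
  where
  rearrange : ∀ e c → e + c + c + 1 ≡ c + (e + c) + 1
  rearrange = solve-∀

pronic-< : ∀ j → j * suc j < suc j * suc (suc j)
pronic-< j = +-mono-≤ (s≤s z≤n) (*-monoʳ-≤ j (n≤1+n (suc j)))

pronic-bracket : ∀ m → ∃ λ j → j * suc j < suc m × suc m ≤ suc j * suc (suc j)
pronic-bracket zero = 0 , z<s , s≤s z≤n
pronic-bracket (suc m) with pronic-bracket m
... | j , lo , hi with suc (suc m) ≤? suc j * suc (suc j)
...   | yes hi′ = j , m<n⇒m<1+n lo , hi′
...   | no ¬hi′ = suc j , ≰⇒> ¬hi′ , ≤-trans (s≤s hi) (pronic-< (suc j))

pronic-bracket-unique : ∀ {n i j} → i * suc i < n → n ≤ suc i * suc (suc i) →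
                        j * suc j < n → n ≤ suc j * suc (suc j) → i ≡ j
pronic-bracket-unique {i = i} {j} loᵢ hiᵢ loⱼ hiⱼ with <-cmp i j
... | tri≈ _ i≡j _ = i≡j
... | tri< i<j _ _ = contradiction (<-≤-trans loⱼ (≤-trans hiᵢ (*-mono-≤ i<j (s≤s i<j)))) (n≮n _)
... | tri> _ _ j<i = contradiction (<-≤-trans loᵢ (≤-trans hiⱼ (*-mono-≤ j<i (s≤s j<i)))) (n≮n _)

k*k∸k+1≡1+[k∸1]*k : ∀ k → k * k ∸ k + 1 ≡ suc ((k ∸ 1) * k)
k*k∸k+1≡1+[k∸1]*k zero = refl
k*k∸k+1≡1+[k∸1]*k (suc j) = trans (cong (_+ 1) (m+n∸m≡n (suc j) (j * suc j))) (+-comm _ 1)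

k*k+k≡k*[1+k] : ∀ k → k * k + k ≡ k * suc k
k*k+k≡k*[1+k] k = trans (+-comm (k * k) k) (sym (*-suc k k))

theorem8p1 : (n : ℕ) → 0 < n →
    Σ ℕ (λ k → (0 < k × k * k ∸ k + 1 ≤ n × n ≤ k * k + k)
      × (∀ k′ → 0 < k′ → k′ * k′ ∸ k′ + 1 ≤ n → n ≤ k′ * k′ + k′ → k′ ≡ k)
      × (n ≤ k * k → IsPhi n (2 * k))
      × (k * k + 1 ≤ n → IsPhi n (2 * k + 1)))
theorem8p1 n@(suc m) _ with pronic-bracket m
... | j , lo , hi =
  k , (z<s , subst (_≤ n) (sym (k*k∸k+1≡1+[k∸1]*k k)) lo , subst (n ≤_) (sym (k*k+k≡k*[1+k] k)) hi) ,
  unique ,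
  (λ n≤k*k → subst (IsPhi n) (even≡ j) (isPhi-balanced j 1 ≤-refl lo n≤k*k)) ,
  (λ k*k+1≤n → subst (IsPhi n) (odd≡ k)
                 (isPhi-balanced k 0 z≤n (subst (_≤ n) (+-comm (k * k) 1) k*k+1≤n) hi))
  where
  k = suc j
  unique : ∀ k′ → 0 < k′ → k′ * k′ ∸ k′ + 1 ≤ n → n ≤ k′ * k′ + k′ → k′ ≡ k
  unique (suc j′) _ lo′ hi′ =
    cong suc (pronic-bracket-unique (subst (_≤ n) (k*k∸k+1≡1+[k∸1]*k (suc j′)) lo′)
                                    (subst (n ≤_) (k*k+k≡k*[1+k] (suc j′)) hi′) lo hi)
  even≡ : ∀ j → j + (1 + j) + 1 ≡ 2 * suc j
  even≡ = solve-∀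
  odd≡ : ∀ k → k + (0 + k) + 1 ≡ 2 * k + 1
  odd≡ = solve-∀
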